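{- Let $\lambda$ and $\mu$ be partitions (not necessarily with $\mu\subseteq\lambda$), and let $\mathbf{b}=(b_1,b_2,\ldots)$ be the flagging induced by $\lambda/\mu$. Let $i$ be a positive integer with $m_i\notin\Delta(\lambda)$. Then $m_i+1+b_i\ge1$ and $\ell^t_{m_i+1+b_i}=-1-m_i$.
   Context: Partitions are weakly decreasing eventually-zero sequences of nonnegative integers. $\ell_i=\lambda_i-i$, $m_i=\mu_i-i$, $\ell^t_i=\lambda^t_i-i$ for $i\ge1$, where $\lambda^t$ is the conjugate partition: $\lambda^t_k=|\{i\ge1:\lambda_i\ge k\}|$. $\Delta(\lambda)=\{\lambda_i-i:i\ge1\}$. The flagging induced by $\lambda/\mu$ is $b_i=\max\{k\ge0:\lambda_k-k\ge\mu_i-i\}$ with $\lambda_0=+\infty$. -}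

module Defs where

open import Data.Nat using (ℕ; zero; suc; _≤_; _<_; _≤?_)
open import Data.Integer as ℤ using (ℤ; +_)
open import Data.List using (List; []; _∷_; length; filter)
open import Data.Product using (Σ; _×_)
open import Data.Unit using (⊤)
open import Relation.Nullary using (¬_)
open import Relation.Binary.PropositionalEquality using (_≡_)

-- A partition is represented by a finite list of its parts, padded with zeros;
-- part l i = λ_i for i ≥ 1 (λ_i = 0 beyond the list).  Index 0 is unused
-- (λ_0 = +∞ is treated separately in the flagging).
part : List ℕ → ℕ → ℕ
part []           _             = 0
part (x ∷ xs)     zero          = 0
part (x ∷ xs)     (suc zero)    = x
part (x ∷ xs)     (suc (suc i)) = part xs (suc i)

-- weakly decreasing (eventually zero is automatic for lists)
IsPartition : List ℕ → Set
IsPartition l = ∀ i → 1 ≤ i → part l (suc i) ≤ part l i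

-- conjugate partition: λ^t_k = |{ j ≥ 1 : λ_j ≥ k }|, for k ≥ 1
-- (entries j beyond the list have λ_j = 0 < k, so only list entries count)
conj : List ℕ → ℕ → ℕ
conj l k = length (filter (k ≤?_) l)

ell : List ℕ → ℕ → ℤ
ell l i = + part l i ℤ.- + i

ellT : List ℕ → ℕ → ℤ
ellT l k = + conj l k ℤ.- + k

_∈Δ_ : ℤ → List ℕ → Set
m ∈Δ l = Σ ℕ λ j → (1 ≤ j) × (ell l j ≡ m)

-- b is the flagging entry b_i induced by λ/μ:
-- b = max { k ≥ 0 : λ_k - k ≥ μ_i - i }, with λ_0 = +∞ (so k = 0 always belongs).
-- Membership of k in that set:
InFlagSet : List ℕ → List ℕ → ℕ → ℕ → Set
InFlagSet lam mu i zero    = ⊤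
InFlagSet lam mu i (suc k) = ell mu i ℤ.≤ ell lam (suc k)

IsFlagging : List ℕ → List ℕ → ℕ → ℕ → Set
IsFlagging lam mu i b = InFlagSet lam mu i b × (∀ k → b < k → ¬ InFlagSet lam mu i k)

{-# OPTIONS --safe #-}
-- With n = m_i + 1 + b_i: maximality of b_i gives λ_{b_i+1} − (b_i+1) < m_i, i.e. λ_{b_i+1} < n
-- (in particular n ≥ 1), while λ_{b_i} − b_i ≥ m_i together with m_i ∉ Δ(λ) makes the inequality
-- strict, i.e. λ_{b_i} ≥ n.  Hence exactly the first b_i parts of λ are ≥ n, so λ^t_n = b_i and
-- ℓ^t_n = b_i − n = −1 − m_i.
module Submission where

open import Defs
open import Data.Nat using (ℕ; zero; suc; _≤_; _<_; _≤?_; z≤n; s≤s; _≤′_; ≤′-refl; ≤′-step)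
open import Data.Nat.Properties using (≤-refl; ≤-trans; ≤-<-trans; <⇒≱; ≤⇒≤′; ≤′⇒≤)
open import Data.Integer as ℤ using (ℤ; +_; ∣_∣; +≤+)
import Data.Integer.Properties as ℤ
open import Data.Integer.Tactic.RingSolver using (solve; solve-∀)
open import Data.List using (List; []; _∷_; length)
open import Data.List.Properties using (filter-accept; filter-reject)
open import Data.Product using (_×_; _,_)
open import Data.Empty using (⊥-elim)
open import Relation.Nullary using (¬_)
open import Relation.Binary.PropositionalEquality using (_≡_; refl; sym; trans; cong; cong₂; subst; module ≡-Reasoning)

part-antitone : ∀ l {j k} → IsPartition l → 1 ≤ j → j ≤ k → part l k ≤ part l j
part-antitone l {j} pl 1≤j j≤k = go (≤⇒≤′ j≤k)
  where
  go : ∀ {k} → j ≤′ k → part l k ≤ part l j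
  go ≤′-refl             = ≤-refl
  go (≤′-step {k} j≤′k) = ≤-trans (pl k (≤-trans 1≤j (≤′⇒≤ j≤′k))) (go j≤′k)

conj≡ : ∀ l k b → 1 ≤ k →
        (∀ j → 1 ≤ j → j ≤ b → k ≤ part l j) → (∀ j → b < j → part l j < k) →
        conj l k ≡ b
conj≡ []       k zero    _   _     _     = refl
conj≡ []       k (suc b) 1≤k large _     = ⊥-elim (<⇒≱ 1≤k (large 1 ≤-refl (s≤s z≤n)))
conj≡ (x ∷ xs) k zero    1≤k _     small =
  trans (cong length (filter-reject (k ≤?_) (<⇒≱ (small 1 (s≤s z≤n)))))
        (conj≡ xs k zero 1≤k (λ { (suc j) _ () })
                             (λ { (suc j) _ → small (suc (suc j)) (s≤s z≤n) }))
conj≡ (x ∷ xs) k (suc b) 1≤k large small =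
  trans (cong length (filter-accept (k ≤?_) (large 1 ≤-refl (s≤s z≤n))))
        (cong suc (conj≡ xs k b 1≤k
          (λ { (suc j) _ j≤b → large (suc (suc j)) (s≤s z≤n) (s≤s j≤b) })
          (λ { (suc j) b<j → small (suc (suc j)) (s≤s b<j) })))

sub-<⇒suc≤ : ∀ x k m → x ℤ.- (+ 1 ℤ.+ k) ℤ.< m → + 1 ℤ.+ x ℤ.≤ m ℤ.+ + 1 ℤ.+ k
sub-<⇒suc≤ x k m h = begin
  + 1 ℤ.+ x                                           ≡⟨ solve (x ∷ k ∷ []) ⟩
  (+ 1 ℤ.+ (x ℤ.- (+ 1 ℤ.+ k))) ℤ.+ (+ 1 ℤ.+ k)     ≤⟨ ℤ.+-monoˡ-≤ (+ 1 ℤ.+ k) (ℤ.i<j⇒suc[i]≤j h) ⟩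
  m ℤ.+ (+ 1 ℤ.+ k)                                   ≡⟨ sym (ℤ.+-assoc m (+ 1) k) ⟩
  m ℤ.+ + 1 ℤ.+ k                                     ∎
  where open ℤ.≤-Reasoning

<-sub⇒suc+≤ : ∀ x k m → m ℤ.< x ℤ.- k → m ℤ.+ + 1 ℤ.+ k ℤ.≤ x
<-sub⇒suc+≤ x k m h = begin
  m ℤ.+ + 1 ℤ.+ k          ≡⟨ solve (m ∷ k ∷ []) ⟩
  (+ 1 ℤ.+ m) ℤ.+ k        ≤⟨ ℤ.+-monoˡ-≤ k (ℤ.i<j⇒suc[i]≤j h) ⟩
  (x ℤ.- k) ℤ.+ k          ≡⟨ solve (x ∷ k ∷ []) ⟩
  x                        ∎
  where open ℤ.≤-Reasoning

sub-suc+≡ : ∀ m k → k ℤ.- (m ℤ.+ + 1 ℤ.+ k) ≡ ℤ.- (+ 1) ℤ.- m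
sub-suc+≡ = solve-∀

flag-above : ∀ {lam mu i b} → IsFlagging lam mu i b →
             + suc (part lam (suc b)) ℤ.≤ ell mu i ℤ.+ + 1 ℤ.+ + b
flag-above {lam} {mu} {i} {b} (_ , maximal) =
  sub-<⇒suc≤ (+ part lam (suc b)) (+ b) (ell mu i) (ℤ.≰⇒> (maximal (suc b) ≤-refl))

flag-below : ∀ {lam mu i b} → IsPartition lam → ¬ (ell mu i ∈Δ lam) → InFlagSet lam mu i b →
             ∀ j → 1 ≤ j → j ≤ b → ell mu i ℤ.+ + 1 ℤ.+ + b ℤ.≤ + part lam j
flag-below {b = zero}  _  _  _      (suc j) _   ()
flag-below {lam} {mu} {i} {suc b} pl m∉Δ inFlag j 1≤j j≤b =
  ℤ.≤-trans (<-sub⇒suc+≤ (+ part lam (suc b)) (+ suc b) (ell mu i) m<ℓ)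
            (+≤+ (part-antitone lam pl 1≤j j≤b))
  where
  m<ℓ : ell mu i ℤ.< ell lam (suc b)
  m<ℓ = ℤ.≤∧≢⇒< inFlag (λ m≡ℓ → m∉Δ (suc b , s≤s z≤n , sym m≡ℓ))

lemma10p13 : (lam mu : List ℕ) → IsPartition lam → IsPartition mu →
    (i : ℕ) → 1 ≤ i → ¬ (ell mu i ∈Δ lam) →
    (b : ℕ) → IsFlagging lam mu i b →
    (+ 1 ℤ.≤ ell mu i ℤ.+ + 1 ℤ.+ + b) ×
    (ellT lam ∣ ell mu i ℤ.+ + 1 ℤ.+ + b ∣ ≡ ℤ.- (+ 1) ℤ.- ell mu i)
lemma10p13 lam mu pl _ i _ m∉Δ b flag@(inFlag , _) = 1≤N , ellT≡
  where
  m = ell mu i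
  N = m ℤ.+ + 1 ℤ.+ + b
  n = ∣ N ∣

  1≤N : + 1 ℤ.≤ N
  1≤N = ℤ.≤-trans (+≤+ (s≤s z≤n)) (flag-above flag)

  n≡N : + n ≡ N
  n≡N = ℤ.0≤i⇒+∣i∣≡i (ℤ.≤-trans (+≤+ z≤n) 1≤N)

  below-n : ∀ {a} → + a ℤ.≤ N → a ≤ n
  below-n a≤N = ℤ.drop‿+≤+ (subst (_ ℤ.≤_) (sym n≡N) a≤N)

  above-n : ∀ {a} → N ℤ.≤ + a → n ≤ a
  above-n N≤a = ℤ.drop‿+≤+ (subst (ℤ._≤ _) (sym n≡N) N≤a)

  conj≡b : conj lam n ≡ b
  conj≡b = conj≡ lam n b (below-n 1≤N)
    (λ j 1≤j j≤b → above-n (flag-below pl m∉Δ inFlag j 1≤j j≤b))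
    (λ j b<j → ≤-<-trans (part-antitone lam pl (s≤s z≤n) b<j) (below-n (flag-above flag)))

  ellT≡ : ellT lam n ≡ ℤ.- (+ 1) ℤ.- m
  ellT≡ = begin
    + conj lam n ℤ.- + n   ≡⟨ cong₂ ℤ._-_ (cong +_ conj≡b) n≡N ⟩
    + b ℤ.- N              ≡⟨ sub-suc+≡ m (+ b) ⟩
    ℤ.- (+ 1) ℤ.- m        ∎
    where open ≡-Reasoning
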